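{- (1-cut) For every sequent $\Gamma$ and formula $A$ of MRL, if $\vdash\Gamma,\emptyset\{A\}$ is derivable in MRL, then $\vdash\Gamma$ is derivable in MRL.
   Context: Fix a set $\Omega$ of roles (possibly infinite). A role set is a subset $R\subseteq\Omega$; $\overline{R}=\Omega\setminus R$; $R_1\uplus\cdots\uplus R_n=\Omega$ means the $R_i$ are pairwise disjoint with union $\Omega$. An ultrafilter on $\Omega$ is a family $\mathcal U$ of subsets of $\Omega$ with $\Omega\in\mathcal U$, closed upward and under binary intersection, and containing $R$ or $\overline R$ for every $R$. For an endomorphism $f:\Omega\to\Omega$, $f^{ -1}(R)=\{r\mid f(r)\in R\}$. Formulas of MRL, over first-order terms $t$ and variables $x$: $A,B::=a\mid\neg_f(A)\mid A\wedge_{\mathcal U}B\mid\forall_{\mathcal U}(\lambda x.A)$ ($a$ primitive formulas, $f$ endomorphisms of $\Omega$, $\mathcal U$ ultrafilters); $A[x:=t]$ is substitution. An i-formula is $R\{A\}$ with $R\subseteq\Omega$; a sequent $\Gamma$ is a finite multiset of i-formulas. Derivable sequents $\vdash\Gamma$ are generated by: (Id) $\vdash R_1\{a\},\ldots,R_n\{a\}$ whenever $R_1\uplus\cdots\uplus R_n=\Omega$; (Weaken) from $\Gamma$ infer $\Gamma,R\{A\}$; (Contract) from $\Gamma,R\{A\},R\{A\}$ infer $\Gamma,R\{A\}$; ($\neg$) from $\Gamma,f^{ -1}(R)\{A\}$ infer $\Gamma,R\{\neg_f(A)\}$; ($\wedge$-neg-l/r) if $R\notin\mathcal U$, from $\Gamma,R\{A\}$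 (resp. $\Gamma,R\{B\}$) infer $\Gamma,R\{A\wedge_{\mathcal U}B\}$; ($\wedge$-pos) if $R\in\mathcal U$, from $\Gamma,R\{A\}$ and $\Gamma,R\{B\}$ infer $\Gamma,R\{A\wedge_{\mathcal U}B\}$; ($\forall$-neg) if $R\notin\mathcal U$, from $\Gamma,R\{A[x:=t]\}$ infer $\Gamma,R\{\forall_{\mathcal U}(\lambda x.A)\}$; ($\forall$-pos) if $R\in\mathcal U$ and $x$ not free in $\Gamma$, from $\Gamma,R\{A\}$ infer $\Gamma,R\{\forall_{\mathcal U}(\lambda x.A)\}$. -}

module Defs where

open import Data.Nat using (ℕ; zero; suc)
open import Data.Bool using (Bool; true; false; not; _∧_; if_then_else_)
open import Data.List using (List; []; _∷_; map)
open import Data.Vec using (Vec; []; _∷_)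
open import Data.Sum using (_⊎_)
open import Relation.Nullary using (¬_)
open import Relation.Binary.PropositionalEquality using (_≡_)
open import Data.List.Relation.Binary.Permutation.Propositional using (_↭_)

record Signature : Set₁ where
  field
    Fun       : Set
    funArity  : Fun → ℕ
    Pred      : Set
    predArity : Pred → ℕ

module MRL (Ω : Set) (Sig : Signature) where
  open Signature Sig

  RoleSet : Set
  RoleSet = Ω → Bool

  ∅ᴿ : RoleSet
  ∅ᴿ = λ _ → false

  Ωᴿ : RoleSet
  Ωᴿ = λ _ → true

  complement : RoleSet → RoleSet
  complement R = λ r → not (R r)

  _∩ᴿ_ : RoleSet → RoleSet → RoleSet
  R ∩ᴿ S = λ r → R r ∧ S r

  _⊆ᴿ_ : RoleSet → RoleSet → Set
  R ⊆ᴿ S = ∀ r → R r ≡ true → S r ≡ true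

  preimage : (Ω → Ω) → RoleSet → RoleSet
  preimage f R = λ r → R (f r)

  record Ultrafilter : Set₁ where
    field
      mem       : RoleSet → Set
      mem-Ω     : mem Ωᴿ
      mem-up    : ∀ {R S} → mem R → R ⊆ᴿ S → mem S
      mem-∩     : ∀ {R S} → mem R → mem S → mem (R ∩ᴿ S)
      mem-ultra : ∀ R → mem R ⊎ mem (complement R)

  _∈ᵁ_ : RoleSet → Ultrafilter → Set
  R ∈ᵁ U = Ultrafilter.mem U R

  data Term : Set where
    var : ℕ → Term
    fn  : (g : Fun) → Vec Term (funArity g) → Term

  -- MRL formulas; the body of ∀ binds de Bruijn index 0.
  data Formula : Set₁ where
    prim : (p : Pred) → Vec Term (predArity p) → Formula
    ¬[_]_ : (Ω → Ω) → Formula → Formula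
    ∧[_] : Ultrafilter → Formula → Formula → Formula
    ∀[_] : Ultrafilter → Formula → Formula

  Subst : Set
  Subst = ℕ → Term

  mutual
    substT : Subst → Term → Term
    substT σ (var x) = σ x
    substT σ (fn g ts) = fn g (substTs σ ts)

    substTs : ∀ {n} → Subst → Vec Term n → Vec Term n
    substTs σ [] = []
    substTs σ (t ∷ ts) = substT σ t ∷ substTs σ ts

  shiftS : Subst
  shiftS x = var (suc x)

  exts : Subst → Subst
  exts σ zero = var zero
  exts σ (suc x) = substT shiftS (σ x)

  substF : Subst → Formula → Formula
  substF σ (prim p ts) = prim p (substTs σ ts)
  substF σ (¬[ f ] A) = ¬[ f ] substF σ A
  substF σ (∧[ U ] A B) = ∧[ U ] (substF σ A) (substF σ B)
  substF σ (∀[ U ] A) = ∀[ U ] (substF (exts σ) A)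

  single : Term → Subst
  single t zero = t
  single t (suc x) = var x

  _[0≔_] : Formula → Term → Formula
  A [0≔ t ] = substF (single t) A

  data IFormula : Set₁ where
    _⟦_⟧ : RoleSet → Formula → IFormula

  -- Sequents: finite multisets of i-formulas, represented as lists
  -- up to permutation (see the exchange rule).
  Sequent : Set₁
  Sequent = List IFormula

  shiftI : IFormula → IFormula
  shiftI (R ⟦ A ⟧) = R ⟦ substF shiftS A ⟧

  shiftSeq : Sequent → Sequent
  shiftSeq = map shiftI

  hits : Ω → List RoleSet → ℕ
  hits r [] = zero
  hits r (R ∷ Rs) = if R r then suc (hits r Rs) else hits r Rs

  -- R₁ ⊎ ⋯ ⊎ Rₙ = Ω : every role lies in exactly one of the Rᵢ
  IsPartition : List RoleSet → Set
  IsPartition Rs = ∀ r → hits r Rs ≡ suc zero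

  infix 4 ⊢_
  data ⊢_ : Sequent → Set₁ where
    ax        : (Rs : List RoleSet) (p : Pred) (ts : Vec Term (predArity p)) →
                IsPartition Rs → ⊢ map (λ R → R ⟦ prim p ts ⟧) Rs
    exchange  : ∀ {Γ Δ} → Γ ↭ Δ → ⊢ Γ → ⊢ Δ
    weaken    : ∀ {Γ R A} → ⊢ Γ → ⊢ (R ⟦ A ⟧ ∷ Γ)
    contract  : ∀ {Γ R A} → ⊢ (R ⟦ A ⟧ ∷ R ⟦ A ⟧ ∷ Γ) → ⊢ (R ⟦ A ⟧ ∷ Γ)
    neg       : ∀ {Γ R f A} → ⊢ (preimage f R ⟦ A ⟧ ∷ Γ) → ⊢ (R ⟦ ¬[ f ] A ⟧ ∷ Γ)
    and-neg-l : ∀ {Γ R U A B} → ¬ (R ∈ᵁ U) → ⊢ (R ⟦ A ⟧ ∷ Γ) → ⊢ (R ⟦ ∧[ U ] A B ⟧ ∷ Γ)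
    and-neg-r : ∀ {Γ R U A B} → ¬ (R ∈ᵁ U) → ⊢ (R ⟦ B ⟧ ∷ Γ) → ⊢ (R ⟦ ∧[ U ] A B ⟧ ∷ Γ)
    and-pos   : ∀ {Γ R U A B} → R ∈ᵁ U → ⊢ (R ⟦ A ⟧ ∷ Γ) → ⊢ (R ⟦ B ⟧ ∷ Γ) →
                ⊢ (R ⟦ ∧[ U ] A B ⟧ ∷ Γ)
    all-neg   : ∀ {Γ R U A} (t : Term) → ¬ (R ∈ᵁ U) → ⊢ (R ⟦ A [0≔ t ] ⟧ ∷ Γ) →
                ⊢ (R ⟦ ∀[ U ] A ⟧ ∷ Γ)
    -- eigenvariable: the bound variable (index 0) is fresh for Γ, which is
    -- expressed by shifting Γ
    all-pos   : ∀ {Γ R U A} → R ∈ᵁ U → ⊢ (R ⟦ A ⟧ ∷ shiftSeq Γ) →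
                ⊢ (R ⟦ ∀[ U ] A ⟧ ∷ Γ)

-- An ∅-labelled i-formula never contributes to a derivation: in an axiom it
-- covers no role, and every rule introducing R{A} with R = ∅ has premises in
-- which the subformulas are again ∅-labelled. Hence all ∅-labelled
-- i-formulas of a derivable sequent can be erased at once, by induction on
-- the derivation; erasing them simultaneously is what makes contraction go
-- through. The only non-local case is ∀-pos, whose eigenvariable shift of
-- the context is undone by closure of derivability under substitution.
module Submission where

open import Defs
open import Data.List using (List; []; _∷_; map; _++_)
open import Data.List.Properties using (map-id; map-∘; map-cong)
open import Data.Nat using (zero; suc)
open import Data.Bool using (if_then_else_)
open import Data.Vec using (Vec; []; _∷_)
open import Data.Product using (Σ; _×_; _,_)
open import Data.Sum using (inj₁; inj₂)
open import Function using (id; _∘_)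
open import Relation.Binary.PropositionalEquality
  using (_≡_; _≗_; refl; sym; cong; cong₂; subst; module ≡-Reasoning)
  renaming (trans to ≡-trans)
open import Data.List.Membership.Propositional using (_∈_)
open import Data.List.Membership.Propositional.Properties using (∈-++⁻; ∈-map⁻; ∈-∃++)
open import Data.List.Relation.Unary.Any using (here)
open import Data.List.Relation.Binary.Permutation.Propositional
open import Data.List.Relation.Binary.Permutation.Propositional.Properties
  using (∈-resp-↭; ↭-empty-inv; map⁺; shift; drop-∷; ++⁺ˡ; ++⁺ʳ)

∈⇒↭-∷ : ∀ {a} {A : Set a} {x : A} {xs} → x ∈ xs → Σ (List A) λ ys → xs ↭ x ∷ ys
∈⇒↭-∷ x∈xs with ys , zs , refl ← ∈-∃++ x∈xs = ys ++ zs , shift _ ys zs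

module Substitution (Ω : Set) (Sig : Signature) where
  open MRL Ω Sig

  _⨾_ : Subst → Subst → Subst
  (σ ⨾ τ) x = substT τ (σ x)

  mutual
    substT-cong : ∀ {σ τ} → σ ≗ τ → ∀ t → substT σ t ≡ substT τ t
    substT-cong σ≗τ (var x) = σ≗τ x
    substT-cong σ≗τ (fn g ts) = cong (fn g) (substTs-cong σ≗τ ts)

    substTs-cong : ∀ {σ τ n} → σ ≗ τ → (ts : Vec Term n) → substTs σ ts ≡ substTs τ ts
    substTs-cong σ≗τ [] = refl
    substTs-cong σ≗τ (t ∷ ts) = cong₂ _∷_ (substT-cong σ≗τ t) (substTs-cong σ≗τ ts)

  mutual
    substT-⨾ : ∀ σ τ t → substT τ (substT σ t) ≡ substT (σ ⨾ τ) t
    substT-⨾ σ τ (var x) = refl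
    substT-⨾ σ τ (fn g ts) = cong (fn g) (substTs-⨾ σ τ ts)

    substTs-⨾ : ∀ {n} σ τ (ts : Vec Term n) → substTs τ (substTs σ ts) ≡ substTs (σ ⨾ τ) ts
    substTs-⨾ σ τ [] = refl
    substTs-⨾ σ τ (t ∷ ts) = cong₂ _∷_ (substT-⨾ σ τ t) (substTs-⨾ σ τ ts)

  mutual
    substT-var : ∀ t → substT var t ≡ t
    substT-var (var x) = refl
    substT-var (fn g ts) = cong (fn g) (substTs-var ts)

    substTs-var : ∀ {n} (ts : Vec Term n) → substTs var ts ≡ ts
    substTs-var [] = refl
    substTs-var (t ∷ ts) = cong₂ _∷_ (substT-var t) (substTs-var ts)

  exts-cong : ∀ {σ τ} → σ ≗ τ → exts σ ≗ exts τ
  exts-cong σ≗τ zero = refl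
  exts-cong σ≗τ (suc x) = cong (substT shiftS) (σ≗τ x)

  exts-⨾ : ∀ σ τ → (exts σ ⨾ exts τ) ≗ exts (σ ⨾ τ)
  exts-⨾ σ τ zero = refl
  exts-⨾ σ τ (suc x) = ≡-trans (substT-⨾ shiftS (exts τ) (σ x)) (sym (substT-⨾ τ shiftS (σ x)))

  exts-var : exts var ≗ var
  exts-var zero = refl
  exts-var (suc x) = refl

  substF-cong : ∀ {σ τ} → σ ≗ τ → ∀ A → substF σ A ≡ substF τ A
  substF-cong σ≗τ (prim p ts) = cong (prim p) (substTs-cong σ≗τ ts)
  substF-cong σ≗τ (¬[ f ] A) = cong (¬[ f ]_) (substF-cong σ≗τ A)
  substF-cong σ≗τ (∧[ U ] A B) = cong₂ (∧[ U ]) (substF-cong σ≗τ A) (substF-cong σ≗τ B)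
  substF-cong σ≗τ (∀[ U ] A) = cong (∀[ U ]) (substF-cong (exts-cong σ≗τ) A)

  substF-⨾ : ∀ σ τ A → substF τ (substF σ A) ≡ substF (σ ⨾ τ) A
  substF-⨾ σ τ (prim p ts) = cong (prim p) (substTs-⨾ σ τ ts)
  substF-⨾ σ τ (¬[ f ] A) = cong (¬[ f ]_) (substF-⨾ σ τ A)
  substF-⨾ σ τ (∧[ U ] A B) = cong₂ (∧[ U ]) (substF-⨾ σ τ A) (substF-⨾ σ τ B)
  substF-⨾ σ τ (∀[ U ] A) =
    cong (∀[ U ]) (≡-trans (substF-⨾ (exts σ) (exts τ) A) (substF-cong (exts-⨾ σ τ) A))

  substF-var : ∀ A → substF var A ≡ A
  substF-var (prim p ts) = cong (prim p) (substTs-var ts)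
  substF-var (¬[ f ] A) = cong (¬[ f ]_) (substF-var A)
  substF-var (∧[ U ] A B) = cong₂ (∧[ U ]) (substF-var A) (substF-var B)
  substF-var (∀[ U ] A) = cong (∀[ U ]) (≡-trans (substF-cong exts-var A) (substF-var A))

  substF-[0≔] : ∀ σ t A → substF σ (A [0≔ t ]) ≡ substF (exts σ) A [0≔ substT σ t ]
  substF-[0≔] σ t A = begin
    substF σ (substF (single t) A)                   ≡⟨ substF-⨾ (single t) σ A ⟩
    substF (single t ⨾ σ) A                          ≡⟨ substF-cong pointwise A ⟩
    substF (exts σ ⨾ single (substT σ t)) A          ≡⟨ substF-⨾ (exts σ) (single (substT σ t)) A ⟨
    substF (single (substT σ t)) (substF (exts σ) A) ∎
    where
    open ≡-Reasoning
    pointwise : (single t ⨾ σ) ≗ (exts σ ⨾ single (substT σ t))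
    pointwise zero = refl
    pointwise (suc x) =
      sym (≡-trans (substT-⨾ shiftS (single (substT σ t)) (σ x)) (substT-var (σ x)))

  substF-exts-shift : ∀ σ A → substF (exts σ) (substF shiftS A) ≡ substF shiftS (substF σ A)
  substF-exts-shift σ A = ≡-trans (substF-⨾ shiftS (exts σ) A) (sym (substF-⨾ σ shiftS A))

  shift-[0≔] : ∀ t A → substF shiftS A [0≔ t ] ≡ A
  shift-[0≔] t A = ≡-trans (substF-⨾ shiftS (single t) A) (substF-var A)

  substI : Subst → IFormula → IFormula
  substI σ (R ⟦ A ⟧) = R ⟦ substF σ A ⟧

  substI-exts-shift : ∀ σ Γ → map (substI (exts σ)) (shiftSeq Γ) ≡ shiftSeq (map (substI σ) Γ)
  substI-exts-shift σ Γ = ≡-trans (sym (map-∘ Γ)) (≡-trans (map-cong pointwise Γ) (map-∘ Γ))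
    where
    pointwise : substI (exts σ) ∘ shiftI ≗ shiftI ∘ substI σ
    pointwise (R ⟦ A ⟧) = cong (R ⟦_⟧) (substF-exts-shift σ A)

  substI-single-shift : ∀ t Γ → map (substI (single t)) (shiftSeq Γ) ≡ Γ
  substI-single-shift t Γ = ≡-trans (sym (map-∘ Γ)) (≡-trans (map-cong pointwise Γ) (map-id Γ))
    where
    pointwise : substI (single t) ∘ shiftI ≗ id
    pointwise (R ⟦ A ⟧) = cong (R ⟦_⟧) (shift-[0≔] t A)

  ⊢-subst : ∀ {Γ} σ → ⊢ Γ → ⊢ map (substI σ) Γ
  ⊢-subst σ (ax Rs p ts part) = subst ⊢_ (map-∘ Rs) (ax Rs p (substTs σ ts) part)
  ⊢-subst σ (exchange Γ↭Δ d) = exchange (map⁺ (substI σ) Γ↭Δ) (⊢-subst σ d)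
  ⊢-subst σ (weaken d) = weaken (⊢-subst σ d)
  ⊢-subst σ (contract d) = contract (⊢-subst σ d)
  ⊢-subst σ (neg d) = neg (⊢-subst σ d)
  ⊢-subst σ (and-neg-l R∉U d) = and-neg-l R∉U (⊢-subst σ d)
  ⊢-subst σ (and-neg-r R∉U d) = and-neg-r R∉U (⊢-subst σ d)
  ⊢-subst σ (and-pos R∈U d e) = and-pos R∈U (⊢-subst σ d) (⊢-subst σ e)
  ⊢-subst σ (all-neg {Γ} {R} {A = A} t R∉U d) =
    all-neg (substT σ t) R∉U
      (subst (λ B → ⊢ R ⟦ B ⟧ ∷ map (substI σ) Γ) (substF-[0≔] σ t A) (⊢-subst σ d))
  ⊢-subst σ (all-pos {Γ} {R} {A = A} R∈U d) =
    all-pos R∈U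
      (subst (λ Δ → ⊢ R ⟦ substF (exts σ) A ⟧ ∷ Δ) (substI-exts-shift σ Γ) (⊢-subst (exts σ) d))

  ⊢-unshift : ∀ {Γ} → ⊢ shiftSeq Γ → ⊢ Γ
  ⊢-unshift {Γ} d = subst ⊢_ (substI-single-shift (var zero) Γ) (⊢-subst (single (var zero)) d)

module ∅-Erasure (Ω : Set) (Sig : Signature) where
  open MRL Ω Sig
  open Signature Sig using (Pred; predArity)
  open Substitution Ω Sig using (⊢-unshift)

  ∅-labelled : List Formula → Sequent
  ∅-labelled = map (∅ᴿ ⟦_⟧)

  data HeadCase (X : IFormula) (Δ : Sequent) (Θ : List Formula) (Γ : Sequent) : Set₁ where
    erased : ∀ B Θ′ → X ≡ ∅ᴿ ⟦ B ⟧ → Δ ↭ ∅-labelled Θ′ ++ Γ → HeadCase X Δ Θ Γ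
    kept   : ∀ Γ′ → Γ ↭ X ∷ Γ′ → Δ ↭ ∅-labelled Θ ++ Γ′ → HeadCase X Δ Θ Γ

  head-case : ∀ {X Δ} Θ Γ → X ∷ Δ ↭ ∅-labelled Θ ++ Γ → HeadCase X Δ Θ Γ
  head-case Θ Γ X∷Δ↭ with ∈-++⁻ (∅-labelled Θ) (∈-resp-↭ X∷Δ↭ (here refl))
  ... | inj₁ X∈∅Θ with B , B∈Θ , refl ← ∈-map⁻ (∅ᴿ ⟦_⟧) X∈∅Θ with Θ′ , Θ↭ ← ∈⇒↭-∷ B∈Θ =
    erased B Θ′ refl (drop-∷ (trans X∷Δ↭ (++⁺ʳ Γ (map⁺ (∅ᴿ ⟦_⟧) Θ↭))))
  ... | inj₂ X∈Γ with Γ′ , Γ↭ ← ∈⇒↭-∷ X∈Γ =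
    kept Γ′ Γ↭ (drop-∷ (trans X∷Δ↭ (trans (++⁺ˡ (∅-labelled Θ) Γ↭) (shift _ (∅-labelled Θ) Γ′))))

  ↭-cons-kept : ∀ {Y Δ} Θ {Γ} → Δ ↭ ∅-labelled Θ ++ Γ → Y ∷ Δ ↭ ∅-labelled Θ ++ Y ∷ Γ
  ↭-cons-kept Θ Δ↭ = trans (prep _ Δ↭) (↭-sym (shift _ (∅-labelled Θ) _))

  shiftSeq-∅-labelled : ∀ Θ Γ →
                        shiftSeq (∅-labelled Θ ++ Γ) ≡ ∅-labelled (map (substF shiftS) Θ) ++ shiftSeq Γ
  shiftSeq-∅-labelled [] Γ = refl
  shiftSeq-∅-labelled (B ∷ Θ) Γ = cong (_ ∷_) (shiftSeq-∅-labelled Θ Γ)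

  ↭-shiftSeq : ∀ {Δ} Θ Γ → Δ ↭ ∅-labelled Θ ++ Γ →
               shiftSeq Δ ↭ ∅-labelled (map (substF shiftS) Θ) ++ shiftSeq Γ
  ↭-shiftSeq Θ Γ Δ↭ = subst (_ ↭_) (shiftSeq-∅-labelled Θ Γ) (map⁺ shiftI Δ↭)

  atoms : (p : Pred) → Vec Term (predArity p) → List RoleSet → Sequent
  atoms p ts = map (_⟦ prim p ts ⟧)

  -- An erased atom is labelled ∅ᴿ and so hits no role.
  erase-atoms : ∀ p ts Rs Θ Γ → atoms p ts Rs ↭ ∅-labelled Θ ++ Γ →
                Σ (List RoleSet) λ Qs → Γ ↭ atoms p ts Qs × (∀ r → hits r Qs ≡ hits r Rs)
  erase-atoms p ts [] Θ Γ Rs↭ with ↭-empty-inv (↭-sym Rs↭)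
  erase-atoms p ts [] [] [] Rs↭ | refl = [] , refl , λ r → refl
  erase-atoms p ts (R ∷ Rs) Θ Γ R∷Rs↭ with head-case Θ Γ R∷Rs↭
  ... | erased B Θ′ refl Rs↭ = erase-atoms p ts Rs Θ′ Γ Rs↭
  ... | kept Γ′ Γ↭ Rs↭ with Qs , Γ′↭ , same-hits ← erase-atoms p ts Rs Θ Γ′ Rs↭ =
    R ∷ Qs , trans Γ↭ (prep _ Γ′↭) , λ r → cong (λ n → if R r then suc n else n) (same-hits r)

  ⊢-erase-∅ : ∀ {Δ} → ⊢ Δ → ∀ Θ Γ → Δ ↭ ∅-labelled Θ ++ Γ → ⊢ Γ
  ⊢-erase-∅ (ax Rs p ts part) Θ Γ Rs↭ with Qs , Γ↭ , same-hits ← erase-atoms p ts Rs Θ Γ Rs↭ =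
    exchange (↭-sym Γ↭) (ax Qs p ts (λ r → ≡-trans (same-hits r) (part r)))
  ⊢-erase-∅ (exchange Δ′↭Δ d) Θ Γ Δ↭ = ⊢-erase-∅ d Θ Γ (trans Δ′↭Δ Δ↭)
  ⊢-erase-∅ (weaken d) Θ Γ X∷Δ↭ with head-case Θ Γ X∷Δ↭
  ... | erased B Θ′ _ Δ↭ = ⊢-erase-∅ d Θ′ Γ Δ↭
  ... | kept Γ′ Γ↭ Δ↭ = exchange (↭-sym Γ↭) (weaken (⊢-erase-∅ d Θ Γ′ Δ↭))
  ⊢-erase-∅ (contract d) Θ Γ X∷Δ↭ with head-case Θ Γ X∷Δ↭
  ... | erased B Θ′ refl Δ↭ = ⊢-erase-∅ d (B ∷ B ∷ Θ′) Γ (prep _ (prep _ Δ↭))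
  ... | kept Γ′ Γ↭ Δ↭ = exchange (↭-sym Γ↭) (contract (⊢-erase-∅ d Θ _
          (↭-cons-kept Θ (↭-cons-kept Θ Δ↭))))
  ⊢-erase-∅ (neg {A = A} d) Θ Γ X∷Δ↭ with head-case Θ Γ X∷Δ↭
  ... | erased B Θ′ refl Δ↭ = ⊢-erase-∅ d (A ∷ Θ′) Γ (prep _ Δ↭)
  ... | kept Γ′ Γ↭ Δ↭ = exchange (↭-sym Γ↭) (neg (⊢-erase-∅ d Θ _ (↭-cons-kept Θ Δ↭)))
  ⊢-erase-∅ (and-neg-l {A = A} R∉U d) Θ Γ X∷Δ↭ with head-case Θ Γ X∷Δ↭
  ... | erased B Θ′ refl Δ↭ = ⊢-erase-∅ d (A ∷ Θ′) Γ (prep _ Δ↭)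
  ... | kept Γ′ Γ↭ Δ↭ = exchange (↭-sym Γ↭) (and-neg-l R∉U (⊢-erase-∅ d Θ _ (↭-cons-kept Θ Δ↭)))
  ⊢-erase-∅ (and-neg-r {B = B} R∉U d) Θ Γ X∷Δ↭ with head-case Θ Γ X∷Δ↭
  ... | erased _ Θ′ refl Δ↭ = ⊢-erase-∅ d (B ∷ Θ′) Γ (prep _ Δ↭)
  ... | kept Γ′ Γ↭ Δ↭ = exchange (↭-sym Γ↭) (and-neg-r R∉U (⊢-erase-∅ d Θ _ (↭-cons-kept Θ Δ↭)))
  ⊢-erase-∅ (and-pos {A = A} R∈U d e) Θ Γ X∷Δ↭ with head-case Θ Γ X∷Δ↭
  ... | erased B Θ′ refl Δ↭ = ⊢-erase-∅ d (A ∷ Θ′) Γ (prep _ Δ↭)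
  ... | kept Γ′ Γ↭ Δ↭ = exchange (↭-sym Γ↭)
          (and-pos R∈U (⊢-erase-∅ d Θ _ (↭-cons-kept Θ Δ↭)) (⊢-erase-∅ e Θ _ (↭-cons-kept Θ Δ↭)))
  ⊢-erase-∅ (all-neg {A = A} t R∉U d) Θ Γ X∷Δ↭ with head-case Θ Γ X∷Δ↭
  ... | erased B Θ′ refl Δ↭ = ⊢-erase-∅ d (A [0≔ t ] ∷ Θ′) Γ (prep _ Δ↭)
  ... | kept Γ′ Γ↭ Δ↭ = exchange (↭-sym Γ↭) (all-neg t R∉U (⊢-erase-∅ d Θ _ (↭-cons-kept Θ Δ↭)))
  ⊢-erase-∅ (all-pos {A = A} R∈U d) Θ Γ X∷Δ↭ with head-case Θ Γ X∷Δ↭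
  ... | erased B Θ′ refl Δ↭ =
    ⊢-unshift (⊢-erase-∅ d (A ∷ map (substF shiftS) Θ′) (shiftSeq Γ) (prep _ (↭-shiftSeq Θ′ Γ Δ↭)))
  ... | kept Γ′ Γ↭ Δ↭ = exchange (↭-sym Γ↭)
          (all-pos R∈U (⊢-erase-∅ d (map (substF shiftS) Θ) _ (↭-cons-kept _ (↭-shiftSeq Θ Γ′ Δ↭))))

lemma5 : (Ω : Set) (Sig : Signature) →
         let open MRL Ω Sig in
         (Γ : Sequent) (A : Formula) → ⊢ (∅ᴿ ⟦ A ⟧ ∷ Γ) → ⊢ Γ
lemma5 Ω Sig Γ A d = ∅-Erasure.⊢-erase-∅ Ω Sig d (A ∷ []) Γ refl
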